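{- Let $\Gamma = \mathcal{N}(n;a,b,c;k)$ be a Nest graph with $c = a + b$ in $\mathbb{Z}_n$. Then the permutation $\tau$ of $V(\Gamma)$ given by $u_i\tau = u_{ -i}$ and $v_i\tau = v_{ -i+c}$ for all $i \in \mathbb{Z}_n$ is an automorphism of $\Gamma$. Consequently, $\Gamma$ is edge-transitive if and only if it is arc-transitive.
   Context: For integers $n \geq 4$ and $1 \leq a,b,c,k \leq n-1$ with $k \neq n/2$ and $a,b,c$ pairwise distinct, the Nest graph $\mathcal{N}(n;a,b,c;k)$ is the graph with vertex set $\{u_i : i \in \mathbb{Z}_n\} \cup \{v_i : i \in \mathbb{Z}_n\}$ and edges $u_iu_{i+1}$, $v_iv_{i+k}$, $u_iv_i$, $u_iv_{i+a}$, $u_iv_{i+b}$, $u_iv_{i+c}$ for $i \in \mathbb{Z}_n$ (indices modulo $n$). Edge-/arc-transitive means the automorphism group acts transitively on edges/arcs. -}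

module Defs where

open import Data.Nat using (ℕ; _+_; _∸_; _*_; _≤_; _<_; NonZero)
open import Data.Nat.DivMod using (_mod_)
open import Data.Fin using (Fin; toℕ)
open import Data.Sum using (_⊎_; inj₁; inj₂)
open import Data.Product using (Σ; _×_; ∃-syntax)
open import Relation.Binary.PropositionalEquality using (_≡_)
open import Relation.Nullary using (¬_)
open import Function.Definitions using (Bijective)
open import Function.Bundles using (_⇔_)

-- Vertices of a Nest graph on 2n vertices: inj₁ i = u_i, inj₂ i = v_i  (i ∈ ℤ_n ≅ Fin n).
V : ℕ → Set
V n = Fin n ⊎ Fin n

[_]_ : ℕ → (n : ℕ) .{{_ : NonZero n}} → Fin n
[ m ] n = m mod n

data NestE (n a b c k : ℕ) .{{_ : NonZero n}} : V n → V n → Set where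
  uu  : ∀ (i : Fin n) → NestE n a b c k (inj₁ i) (inj₁ ([ toℕ i + 1 ] n))
  vv  : ∀ (i : Fin n) → NestE n a b c k (inj₂ i) (inj₂ ([ toℕ i + k ] n))
  uv₀ : ∀ (i : Fin n) → NestE n a b c k (inj₁ i) (inj₂ i)
  uvₐ : ∀ (i : Fin n) → NestE n a b c k (inj₁ i) (inj₂ ([ toℕ i + a ] n))
  uvᵦ : ∀ (i : Fin n) → NestE n a b c k (inj₁ i) (inj₂ ([ toℕ i + b ] n))
  uvc : ∀ (i : Fin n) → NestE n a b c k (inj₁ i) (inj₂ ([ toℕ i + c ] n))

NestAdj : (n a b c k : ℕ) .{{_ : NonZero n}} → V n → V n → Set
NestAdj n a b c k x y = NestE n a b c k x y ⊎ NestE n a b c k y x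

NestParams : ℕ → ℕ → ℕ → ℕ → ℕ → Set
NestParams n a b c k =
  (4 ≤ n) × (1 ≤ a) × (a < n) × (1 ≤ b) × (b < n) × (1 ≤ c) × (c < n)
  × (1 ≤ k) × (k < n) × ¬ (2 * k ≡ n)
  × ¬ (a ≡ b) × ¬ (a ≡ c) × ¬ (b ≡ c)

IsAut : {X : Set} → (X → X → Set) → (X → X) → Set
IsAut Adj σ = Bijective _≡_ _≡_ σ × (∀ x y → Adj x y ⇔ Adj (σ x) (σ y))

EdgeTransitive : {X : Set} → (X → X → Set) → Set
EdgeTransitive {X} Adj = ∀ x y x' y' → Adj x y → Adj x' y' →
  ∃[ σ ] (IsAut Adj σ × ((σ x ≡ x' × σ y ≡ y') ⊎ (σ x ≡ y' × σ y ≡ x')))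

ArcTransitive : {X : Set} → (X → X → Set) → Set
ArcTransitive {X} Adj = ∀ x y x' y' → Adj x y → Adj x' y' →
  ∃[ σ ] (IsAut Adj σ × σ x ≡ x' × σ y ≡ y')

τ : (n c : ℕ) .{{_ : NonZero n}} → V n → V n
τ n c (inj₁ i) = inj₁ ([ n ∸ toℕ i ] n)
τ n c (inj₂ i) = inj₂ ([ n ∸ toℕ i + c ] n)

-- Index both rims by ℤₙ and let ρ_d be the reflection u_i ↦ u_{d-i}, v_i ↦ v_{d+c-i}, so that
-- τ = ρ_0. It reverses the rim edges u_i u_{i+1} and v_i v_{i+k}, and sends a spoke u_i v_{i+s}
-- to the spoke u_j v_{j+c-s} with j = d - i; as c = a + b, the spoke offsets 0, a, b, c are
-- permuted as c, b, a, 0. Hence every ρ_d is an involutive automorphism. Since ρ_{2i+1} swaps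
-- the ends of the edge u_i u_{i+1}, edge-transitivity forces arc-transitivity.
module Submission where

open import Defs
open import Data.Nat using (ℕ; suc; _+_; _*_; _∸_; _≤_; NonZero)
open import Data.Product using (_×_; _,_; ∃-syntax; map₂)
open import Relation.Binary.PropositionalEquality using (_≡_)
open import Function.Bundles using (_⇔_)

import Data.Nat.Properties as ℕ
open import Data.Nat.DivMod using (_%_; _/_; m≡m%n+[m/n]*n; [m+kn]%n≡m%n; m%n<n; m<n⇒m%n≡m)
open import Data.Integer as ℤ using (ℤ; +_; -[1+_]; -_; _-_; 0ℤ; 1ℤ)
import Data.Integer.Properties as ℤ
open import Data.Integer.Divisibility.Signed using (_∣_; divides; ∣m∣n⇒∣m+n; ∣m⇒∣-m)
open import Data.Integer.Tactic.RingSolver using (solve-∀)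
open import Data.Fin using (Fin; toℕ)
open import Data.Fin.Properties using (toℕ-injective; toℕ-fromℕ<; toℕ<n)
open import Data.Sum using (_⊎_; inj₁; inj₂; swap)
open import Function.Base using (_∘_)
open import Function.Bundles using (mk⇔)
open import Function.Consequences.Propositional
  using (inverseᵇ⇒bijective; strictlyInverseˡ⇒inverseˡ; strictlyInverseʳ⇒inverseʳ)
open import Function.Construct.Composition using (_⇔-∘_)
import Function.Construct.Composition as Composition
open import Relation.Binary.Bundles using (Setoid)
open import Relation.Binary.PropositionalEquality
  using (refl; sym; trans; cong; subst; subst₂; module ≡-Reasoning)
import Relation.Binary.Reasoning.Setoid as SetoidReasoning

module _ {X : Set} {Adj : X → X → Set} where

  involution⇒isAut : ∀ {f : X → X} → (∀ x → f (f x) ≡ x) →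
                     (∀ {x y} → Adj x y → Adj (f x) (f y)) → IsAut Adj f
  involution⇒isAut {f} f∘f≗id f-pres =
    inverseᵇ⇒bijective (strictlyInverseˡ⇒inverseˡ f f∘f≗id , strictlyInverseʳ⇒inverseʳ f f∘f≗id) ,
    λ x y → mk⇔ f-pres (subst₂ Adj (f∘f≗id x) (f∘f≗id y) ∘ f-pres)

  isAut-∘ : ∀ {f g : X → X} → IsAut Adj f → IsAut Adj g → IsAut Adj (g ∘ f)
  isAut-∘ {f} (f-bij , f-pres) (g-bij , g-pres) =
    Composition.bijective _≡_ _≡_ _≡_ f-bij g-bij ,
    λ x y → g-pres (f x) (f y) ⇔-∘ f-pres x y

  isAut-cong : ∀ {f g : X → X} → (∀ x → f x ≡ g x) → IsAut Adj f → IsAut Adj g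
  isAut-cong {f} {g} f≗g ((f-inj , f-surj) , f-pres) =
    (g-inj , g-surj) ,
    λ x y → subst₂ (λ u v → Adj x y ⇔ Adj u v) (f≗g x) (f≗g y) (f-pres x y)
    where
    g-inj : ∀ {x y} → g x ≡ g y → x ≡ y
    g-inj {x} {y} gx≡gy = f-inj (trans (f≗g x) (trans gx≡gy (sym (f≗g y))))
    g-surj : ∀ y → ∃[ x ] (∀ {z} → z ≡ x → g z ≡ y)
    g-surj y with f-surj y
    ... | x , fz≡y = x , λ {z} z≡x → trans (sym (f≗g z)) (fz≡y z≡x)

  ArcMap : X → X → X → X → Set
  ArcMap x y x′ y′ = ∃[ σ ] (IsAut Adj σ × σ x ≡ x′ × σ y ≡ y′)

  EdgeMap : X → X → X → X → Set
  EdgeMap x y x′ y′ = ∃[ σ ] (IsAut Adj σ × ((σ x ≡ x′ × σ y ≡ y′) ⊎ (σ x ≡ y′ × σ y ≡ x′)))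

  arcMap-∘ : ∀ {x y x′ y′ x″ y″} → ArcMap x y x′ y′ → ArcMap x′ y′ x″ y″ → ArcMap x y x″ y″
  arcMap-∘ (σ , σ-aut , refl , refl) (π , π-aut , refl , refl) =
    π ∘ σ , isAut-∘ σ-aut π-aut , refl , refl

  arcMap-swap : ∀ {x y x′ y′} → ArcMap x y x′ y′ → ArcMap y x y′ x′
  arcMap-swap (σ , σ-aut , σx , σy) = σ , σ-aut , σy , σx

  module _ {x₀ y₀ : X} (reversal : ArcMap x₀ y₀ y₀ x₀) where

    edgeMap⇒arcMapᵗ : ∀ {x y} → EdgeMap x y x₀ y₀ → ArcMap x y x₀ y₀
    edgeMap⇒arcMapᵗ (σ , σ-aut , inj₁ (σx , σy)) = σ , σ-aut , σx , σy
    edgeMap⇒arcMapᵗ (σ , σ-aut , inj₂ (σx , σy)) =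
      arcMap-∘ (σ , σ-aut , σx , σy) (arcMap-swap reversal)

    edgeMap⇒arcMapˢ : ∀ {x y} → EdgeMap x₀ y₀ x y → ArcMap x₀ y₀ x y
    edgeMap⇒arcMapˢ (σ , σ-aut , inj₁ (σx₀ , σy₀)) = σ , σ-aut , σx₀ , σy₀
    edgeMap⇒arcMapˢ (σ , σ-aut , inj₂ (σx₀ , σy₀)) = arcMap-∘ reversal (σ , σ-aut , σy₀ , σx₀)

    edgeTransitive⇒arcTransitive : Adj x₀ y₀ → EdgeTransitive Adj → ArcTransitive Adj
    edgeTransitive⇒arcTransitive x₀~y₀ et x y x′ y′ x~y x′~y′ =
      arcMap-∘ (edgeMap⇒arcMapᵗ (et x y x₀ y₀ x~y x₀~y₀))
               (edgeMap⇒arcMapˢ (et x₀ y₀ x′ y′ x₀~y₀ x′~y′))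

  arcTransitive⇒edgeTransitive : ArcTransitive Adj → EdgeTransitive Adj
  arcTransitive⇒edgeTransitive at x y x′ y′ x~y x′~y′ = map₂ (map₂ inj₁) (at x y x′ y′ x~y x′~y′)

module Congruence (n : ℕ) .{{_ : NonZero n}} where

  infix 4 _≈_
  record _≈_ (z w : ℤ) : Set where
    constructor mk≈
    field n∣z-w : + n ∣ z - w

  ≈-reflexive : ∀ {z w} → z ≡ w → z ≈ w
  ≈-reflexive {z} refl = mk≈ (divides 0ℤ (identity z))
    where
    identity : ∀ z → z - z ≡ 0ℤ ℤ.* + n
    identity = solve-∀

  ≈-refl : ∀ {z} → z ≈ z
  ≈-refl = ≈-reflexive refl

  ≈-sym : ∀ {z w} → z ≈ w → w ≈ z
  ≈-sym {z} {w} (mk≈ n∣z-w) = mk≈ (subst (+ n ∣_) (identity z w) (∣m⇒∣-m n∣z-w))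
    where
    identity : ∀ z w → - (z - w) ≡ w - z
    identity = solve-∀

  ≈-trans : ∀ {z w v} → z ≈ w → w ≈ v → z ≈ v
  ≈-trans {z} {w} {v} (mk≈ n∣z-w) (mk≈ n∣w-v) =
    mk≈ (subst (+ n ∣_) (identity z w v) (∣m∣n⇒∣m+n n∣z-w n∣w-v))
    where
    identity : ∀ z w v → (z - w) ℤ.+ (w - v) ≡ z - v
    identity = solve-∀

  ≈-setoid : Setoid _ _
  ≈-setoid = record
    { _≈_ = _≈_
    ; isEquivalence = record { refl = ≈-refl ; sym = ≈-sym ; trans = ≈-trans }
    }

  +-cong : ∀ {z z′ w w′} → z ≈ z′ → w ≈ w′ → z ℤ.+ w ≈ z′ ℤ.+ w′
  +-cong {z} {z′} {w} {w′} (mk≈ n∣z-z′) (mk≈ n∣w-w′) =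
    mk≈ (subst (+ n ∣_) (identity z z′ w w′) (∣m∣n⇒∣m+n n∣z-z′ n∣w-w′))
    where
    identity : ∀ z z′ w w′ → (z - z′) ℤ.+ (w - w′) ≡ (z ℤ.+ w) - (z′ ℤ.+ w′)
    identity = solve-∀

  +-congˡ : ∀ z {w w′} → w ≈ w′ → z ℤ.+ w ≈ z ℤ.+ w′
  +-congˡ z = +-cong (≈-refl {z})

  +-congʳ : ∀ {z z′} w → z ≈ z′ → z ℤ.+ w ≈ z′ ℤ.+ w
  +-congʳ w z≈z′ = +-cong z≈z′ (≈-refl {w})

  n∸m≈-m : ∀ {m} → m ≤ n → + (n ∸ m) ≈ - + m
  n∸m≈-m {m} m≤n = mk≈ (divides 1ℤ (begin
    + (n ∸ m) - - + m   ≡⟨ cong (λ z → + (n ∸ m) ℤ.+ z) (ℤ.neg-involutive (+ m)) ⟩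
    + (n ∸ m + m)       ≡⟨ cong +_ (ℕ.m∸n+n≡m m≤n) ⟩
    + n                 ≡⟨ ℤ.*-identityˡ (+ n) ⟨
    1ℤ ℤ.* + n          ∎))
    where open ≡-Reasoning

  %-cong-nonneg : ∀ m m′ q → + m - + m′ ≡ + q ℤ.* + n → m % n ≡ m′ % n
  %-cong-nonneg m m′ q m-m′≡qn = trans (cong (_% n) m≡m′+qn) ([m+kn]%n≡m%n m′ q n)
    where
    identity : ∀ x y → x ≡ y ℤ.+ (x - y)
    identity = solve-∀
    m≡m′+qn : m ≡ m′ + q * n
    m≡m′+qn = ℤ.+-injective (begin
      + m                        ≡⟨ identity (+ m) (+ m′) ⟩
      + m′ ℤ.+ (+ m - + m′)      ≡⟨ cong (λ z → + m′ ℤ.+ z) m-m′≡qn ⟩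
      + m′ ℤ.+ + q ℤ.* + n       ≡⟨ cong (λ z → + m′ ℤ.+ z) (ℤ.pos-* q n) ⟨
      + (m′ + q * n)             ∎)
      where open ≡-Reasoning

  %-cong : ∀ m m′ → + m ≈ + m′ → m % n ≡ m′ % n
  %-cong m m′ (mk≈ (divides (+ q) m-m′≡qn)) = %-cong-nonneg m m′ q m-m′≡qn
  %-cong m m′ (mk≈ (divides -[1+ q ] m-m′≡qn)) = sym (%-cong-nonneg m′ m (suc q) m′-m≡qn)
    where
    identity : ∀ x y → y - x ≡ - (x - y)
    identity = solve-∀
    m′-m≡qn : + m′ - + m ≡ + suc q ℤ.* + n
    m′-m≡qn = trans (identity (+ m) (+ m′))
                    (trans (cong -_ m-m′≡qn) (ℤ.neg-distribˡ-* -[1+ q ] (+ n)))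

  ⟦_⟧ : Fin n → ℤ
  ⟦ i ⟧ = + toℕ i

  ⟦⟧-injective : ∀ {i j} → ⟦ i ⟧ ≈ ⟦ j ⟧ → i ≡ j
  ⟦⟧-injective {i} {j} i≈j = toℕ-injective (begin
    toℕ i       ≡⟨ m<n⇒m%n≡m (toℕ<n i) ⟨
    toℕ i % n   ≡⟨ %-cong (toℕ i) (toℕ j) i≈j ⟩
    toℕ j % n   ≡⟨ m<n⇒m%n≡m (toℕ<n j) ⟩
    toℕ j       ∎)
    where open ≡-Reasoning

  ⟦[_]⟧ : ∀ m → ⟦ [ m ] n ⟧ ≈ + m
  ⟦[ m ]⟧ = ≈-sym (mk≈ (divides (+ (m / n)) (begin
    + m - + toℕ ([ m ] n)          ≡⟨ cong (λ r → + m - + r) (toℕ-fromℕ< (m%n<n m n)) ⟩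
    + m - + (m % n)                ≡⟨ cong (λ x → + x - + (m % n)) (m≡m%n+[m/n]*n m n) ⟩
    + (m % n + m / n * n) - + (m % n) ≡⟨ identity (+ (m % n)) (+ (m / n * n)) ⟩
    + (m / n * n)                  ≡⟨ ℤ.pos-* (m / n) n ⟩
    + (m / n) ℤ.* + n              ∎)))
    where
    open ≡-Reasoning
    identity : ∀ x y → (x ℤ.+ y) - x ≡ y
    identity = solve-∀

  []≡⇒≈ : ∀ m m′ → [ m ] n ≡ [ m′ ] n → + m ≈ + m′
  []≡⇒≈ m m′ [m]≡[m′] =
    ≈-trans (≈-sym ⟦[ m ]⟧) (≈-trans (≈-reflexive (cong ⟦_⟧ [m]≡[m′])) ⟦[ m′ ]⟧)

module Reflection (n : ℕ) .{{_ : NonZero n}} where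

  open Congruence n
  open SetoidReasoning ≈-setoid

  infixl 6 _+ₙ_
  _+ₙ_ : Fin n → ℕ → Fin n
  i +ₙ s = [ toℕ i + s ] n

  -- d - i in ℤₙ, written as in the definition of τ.
  reflect : ℕ → Fin n → Fin n
  reflect d i = [ d + (n ∸ toℕ i) ] n

  ⟦+ₙ⟧ : ∀ i s → ⟦ i +ₙ s ⟧ ≈ ⟦ i ⟧ ℤ.+ + s
  ⟦+ₙ⟧ i s = ⟦[ toℕ i + s ]⟧

  reflect-inverse : ∀ d i → ⟦ i ⟧ ℤ.+ ⟦ reflect d i ⟧ ≈ + d
  reflect-inverse d i = begin
    ⟦ i ⟧ ℤ.+ ⟦ reflect d i ⟧        ≈⟨ +-congˡ ⟦ i ⟧ ⟦[ d + (n ∸ toℕ i) ]⟧ ⟩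
    ⟦ i ⟧ ℤ.+ (+ d ℤ.+ + (n ∸ toℕ i)) ≈⟨ +-congˡ ⟦ i ⟧ (+-congˡ (+ d) (n∸m≈-m (ℕ.<⇒≤ (toℕ<n i)))) ⟩
    ⟦ i ⟧ ℤ.+ (+ d - ⟦ i ⟧)          ≡⟨ identity ⟦ i ⟧ (+ d) ⟩
    + d                              ∎
    where
    identity : ∀ x y → x ℤ.+ (y - x) ≡ y
    identity = solve-∀

  reflect-unique : ∀ {d i j} → ⟦ i ⟧ ℤ.+ ⟦ j ⟧ ≈ + d → reflect d i ≡ j
  reflect-unique {d} {i} {j} i+j≈d = ⟦⟧-injective (begin
    ⟦ reflect d i ⟧                        ≡⟨ identity ⟦ i ⟧ ⟦ reflect d i ⟧ ⟩
    (⟦ i ⟧ ℤ.+ ⟦ reflect d i ⟧) - ⟦ i ⟧    ≈⟨ +-congʳ (- ⟦ i ⟧) (reflect-inverse d i) ⟩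
    + d - ⟦ i ⟧                            ≈⟨ +-congʳ (- ⟦ i ⟧) i+j≈d ⟨
    (⟦ i ⟧ ℤ.+ ⟦ j ⟧) - ⟦ i ⟧              ≡⟨ identity ⟦ i ⟧ ⟦ j ⟧ ⟨
    ⟦ j ⟧                                  ∎)
    where
    identity : ∀ x y → y ≡ (x ℤ.+ y) - x
    identity = solve-∀

  reflect-swap : ∀ i j → reflect (toℕ i + toℕ j) i ≡ j
  reflect-swap i j = reflect-unique {i = i} ≈-refl

  reflect-involutive : ∀ d i → reflect d (reflect d i) ≡ i
  reflect-involutive d i =
    reflect-unique (≈-trans (≈-reflexive (ℤ.+-comm ⟦ reflect d i ⟧ ⟦ i ⟧)) (reflect-inverse d i))

  reflect-congˡ : ∀ {d e} i → + d ≈ + e → reflect d i ≡ reflect e i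
  reflect-congˡ {e = e} i d≈e = reflect-unique (≈-trans (reflect-inverse e i) (≈-sym d≈e))

  reflect-+ₙ : ∀ d i t → reflect d i +ₙ t ≡ reflect (d + t) i
  reflect-+ₙ d i t = sym (reflect-unique (begin
    ⟦ i ⟧ ℤ.+ ⟦ reflect d i +ₙ t ⟧           ≈⟨ +-congˡ ⟦ i ⟧ (⟦+ₙ⟧ (reflect d i) t) ⟩
    ⟦ i ⟧ ℤ.+ (⟦ reflect d i ⟧ ℤ.+ + t)      ≡⟨ ℤ.+-assoc ⟦ i ⟧ ⟦ reflect d i ⟧ (+ t) ⟨
    (⟦ i ⟧ ℤ.+ ⟦ reflect d i ⟧) ℤ.+ + t      ≈⟨ +-congʳ (+ t) (reflect-inverse d i) ⟩
    + (d + t)                                ∎))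

  reflect-shift : ∀ d i s → reflect d i ≡ reflect (d + s) (i +ₙ s)
  reflect-shift d i s = sym (reflect-unique (begin
    ⟦ i +ₙ s ⟧ ℤ.+ ⟦ reflect d i ⟧           ≈⟨ +-congʳ ⟦ reflect d i ⟧ (⟦+ₙ⟧ i s) ⟩
    (⟦ i ⟧ ℤ.+ + s) ℤ.+ ⟦ reflect d i ⟧      ≡⟨ identity ⟦ i ⟧ (+ s) ⟦ reflect d i ⟧ ⟩
    (⟦ i ⟧ ℤ.+ ⟦ reflect d i ⟧) ℤ.+ + s      ≈⟨ +-congʳ (+ s) (reflect-inverse d i) ⟩
    + (d + s)                                ∎))
    where
    identity : ∀ x y z → (x ℤ.+ y) ℤ.+ z ≡ (x ℤ.+ z) ℤ.+ y
    identity = solve-∀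

  reflect-+ₙ-cancel : ∀ d i s → reflect d (i +ₙ s) +ₙ s ≡ reflect d i
  reflect-+ₙ-cancel d i s = trans (reflect-+ₙ d (i +ₙ s) s) (sym (reflect-shift d i s))

  reflect-+ₙ-shift : ∀ {d e} i s t → + (d + t + s) ≈ + e → reflect d i +ₙ t ≡ reflect e (i +ₙ s)
  reflect-+ₙ-shift {d} i s t d+t+s≈e =
    trans (reflect-+ₙ d i t) (trans (reflect-shift (d + t) i s) (reflect-congˡ (i +ₙ s) d+t+s≈e))

module NestReflection (n a b c k : ℕ) .{{_ : NonZero n}}
                      (c≈a+b : Congruence._≈_ n (+ c) (+ (a + b))) where

  open Congruence n
  open Reflection n

  Edge : V n → V n → Set
  Edge = NestE n a b c k

  Adjacent : V n → V n → Set
  Adjacent = NestAdj n a b c k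

  reflection : ℕ → V n → V n
  reflection d (inj₁ i) = inj₁ (reflect d i)
  reflection d (inj₂ i) = inj₂ (reflect (d + c) i)

  reflection-involutive : ∀ d x → reflection d (reflection d x) ≡ x
  reflection-involutive d (inj₁ i) = cong inj₁ (reflect-involutive d i)
  reflection-involutive d (inj₂ i) = cong inj₂ (reflect-involutive (d + c) i)

  τ≗reflection₀ : ∀ x → τ n c x ≡ reflection 0 x
  τ≗reflection₀ (inj₁ i) = refl
  τ≗reflection₀ (inj₂ i) = cong (λ m → inj₂ ([ m ] n)) (ℕ.+-comm (n ∸ toℕ i) c)

  d+t+s≈d+c : ∀ d {s t} → s + t ≡ a + b → + (d + t + s) ≈ + (d + c)
  d+t+s≈d+c d {s} {t} s+t≡a+b = begin
    + (d + t + s)        ≡⟨ cong +_ (trans (ℕ.+-assoc d t s) (cong (λ m → d + m) (ℕ.+-comm t s))) ⟩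
    + d ℤ.+ + (s + t)    ≡⟨ cong (λ m → + d ℤ.+ + m) s+t≡a+b ⟩
    + d ℤ.+ + (a + b)    ≈⟨ +-congˡ (+ d) c≈a+b ⟨
    + (d + c)            ∎
    where open SetoidReasoning ≈-setoid

  reflection-edge : ∀ d {x y} → Edge x y → Adjacent (reflection d x) (reflection d y)
  reflection-edge d (uu i)  = inj₂ (subst (Edge _) (cong inj₁ (reflect-+ₙ-cancel d i 1)) (uu _))
  reflection-edge d (vv i)  =
    inj₂ (subst (Edge _) (cong inj₂ (reflect-+ₙ-cancel (d + c) i k)) (vv _))
  reflection-edge d (uv₀ i) = inj₁ (subst (Edge _) (cong inj₂ (reflect-+ₙ d i c)) (uvc _))
  reflection-edge d (uvₐ i) =
    inj₁ (subst (Edge _) (cong inj₂ (reflect-+ₙ-shift i a b (d+t+s≈d+c d refl))) (uvᵦ _))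
  reflection-edge d (uvᵦ i) =
    inj₁ (subst (Edge _) (cong inj₂ (reflect-+ₙ-shift i b a (d+t+s≈d+c d (ℕ.+-comm b a)))) (uvₐ _))
  reflection-edge d (uvc i) = inj₁ (subst (Edge _) (cong inj₂ (reflect-shift d i c)) (uv₀ _))

  reflection-adjacent : ∀ d {x y} → Adjacent x y → Adjacent (reflection d x) (reflection d y)
  reflection-adjacent d (inj₁ x→y) = reflection-edge d x→y
  reflection-adjacent d (inj₂ y→x) = swap (reflection-edge d y→x)

  reflection-isAut : ∀ d → IsAut Adjacent (reflection d)
  reflection-isAut d = involution⇒isAut (reflection-involutive d) (reflection-adjacent d)

  τ-isAut : IsAut Adjacent (τ n c)
  τ-isAut = isAut-cong (λ x → sym (τ≗reflection₀ x)) (reflection-isAut 0)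

  reflection-reverses : ∀ i j → ArcMap (inj₁ i) (inj₁ j) (inj₁ j) (inj₁ i)
  reflection-reverses i j = reflection ρ , reflection-isAut ρ , cong inj₁ (reflect-swap i j) ,
    cong inj₁ (trans (cong (reflect ρ) (sym (reflect-swap i j))) (reflect-involutive ρ i))
    where
    ρ : ℕ
    ρ = toℕ i + toℕ j

lemma3p1 : (n a b c k : ℕ) .{{_ : NonZero n}} → NestParams n a b c k →
    [ c ] n ≡ [ a + b ] n →
    IsAut (NestAdj n a b c k) (τ n c)
    × (EdgeTransitive (NestAdj n a b c k) ⇔ ArcTransitive (NestAdj n a b c k))
lemma3p1 n a b c k _ [c]≡[a+b] =
  τ-isAut , mk⇔ (edgeTransitive⇒arcTransitive (reflection-reverses i₀ (i₀ +ₙ 1)) (inj₁ (uu i₀)))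
                arcTransitive⇒edgeTransitive
  where
  open Congruence n using ([]≡⇒≈)
  open Reflection n using (_+ₙ_)
  open NestReflection n a b c k ([]≡⇒≈ c (a + b) [c]≡[a+b])
  i₀ : Fin n
  i₀ = [ 0 ] n
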